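{- Let $G$ be a graph and $e=xy\in E(G)$. (a) If $S$ is an adjacency resolving set of $G$, then $S\cup\{x,y\}$ is an adjacency resolving set of $G-e$. (b) If $R$ is an adjacency resolving set of $G-e$, then $R\cup\{x,y\}$ is an adjacency resolving set of $G$.
   Context: All graphs are finite, simple and undirected; $G-e$ is the graph obtained from $G$ by deleting the edge $e$. For vertices $u,w$ of a graph $H$, $d(u,w)$ is the length of a shortest $u$–$w$ path in $H$ ($\infty$ if in different components) and $d_1(u,w)=\min\{d(u,w),2\}$. A set $S\subseteq V(H)$ is an adjacency resolving set of $H$ if for any two distinct $u,w\in V(H)$ there is $z\in S$ with $d_1(u,z)\neq d_1(w,z)$ (distances computed in $H$). -}

module Defs where

open import Data.Nat using (ℕ)
open import Data.Bool using (Bool; true; false; _∧_; _∨_; not; T)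
open import Data.Fin using (Fin)
open import Data.Fin.Properties using (_≟_)
open import Data.Fin.Subset using (Subset; _∈_)
open import Data.Product using (Σ; ∃; _×_; _,_)
open import Relation.Nullary using (¬_; does)
open import Relation.Binary.PropositionalEquality using (_≡_; _≢_)

record Graph (n : ℕ) : Set where
  field
    adj     : Fin n → Fin n → Bool
    symm    : ∀ u w → adj u w ≡ adj w u
    irrefl  : ∀ u → adj u u ≡ false
open Graph public

IsEdge : ∀ {n} → Graph n → Fin n → Fin n → Set
IsEdge G x y = T (adj G x y)

sameEdge : ∀ {n} → Fin n → Fin n → Fin n → Fin n → Bool
sameEdge x y u w = (does (u ≟ x) ∧ does (w ≟ y)) ∨ (does (u ≟ y) ∧ does (w ≟ x))

deleteEdge : ∀ {n} → (G : Graph n) → Fin n → Fin n → Graph n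
deleteEdge {n} G x y = record
  { adj    = λ u w → adj G u w ∧ not (sameEdge x y u w)
  ; symm   = sy
  ; irrefl = ir
  }
  where
  open import Data.Bool.Properties using (∧-comm; ∨-comm)
  open import Relation.Binary.PropositionalEquality using (cong₂; refl; trans)
  swap : ∀ u w → sameEdge x y u w ≡ sameEdge x y w u
  swap u w = trans (∨-comm (does (u ≟ x) ∧ does (w ≟ y)) (does (u ≟ y) ∧ does (w ≟ x)))
             (cong₂ _∨_ (∧-comm (does (u ≟ y)) (does (w ≟ x))) (∧-comm (does (u ≟ x)) (does (w ≟ y))))
  sy : ∀ u w → (adj G u w ∧ not (sameEdge x y u w)) ≡ (adj G w u ∧ not (sameEdge x y w u))
  sy u w = cong₂ (λ a b → a ∧ not b) (symm G u w) (swap u w)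
  ir : ∀ u → (adj G u u ∧ not (sameEdge x y u u)) ≡ false
  ir u rewrite irrefl G u = refl

-- d₁(u,w) = min{d(u,w), 2} in G.  Since d(u,w) = 0 iff u = w and
-- d(u,w) = 1 iff u,w are adjacent, this is literally:
d₁ : ∀ {n} → Graph n → Fin n → Fin n → ℕ
d₁ G u w with u ≟ w
... | Relation.Nullary.yes _ = 0
... | Relation.Nullary.no _ with adj G u w
...   | true  = 1
...   | false = 2

AdjResolving : ∀ {n} → Graph n → Subset n → Set
AdjResolving {n} G S =
  (u w : Fin n) → u ≢ w → Σ (Fin n) λ z → z ∈ S × d₁ G u z ≢ d₁ G w z

module Submission where

-- Deleting the edge e = xy changes adjacency only on pairs
-- having x or y as an endpoint.  We prove a more general transfer fact:
-- if two graphs H, H' on the same vertices agree on every pair {a,b} with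
-- a outside a vertex set T, then every adjacency resolving set S of H
-- gives the adjacency resolving set S ∪ T of H'.  For u ≠ w:
--   * if u or w lies in T, that vertex resolves the pair itself, since
--     d₁(v,v) = 0 while d₁(v',v) > 0 for v' ≠ v;
--   * otherwise a vertex z ∈ S resolving u,w in H also resolves them in H',
--     because d₁(u,z) and d₁(w,z) only depend on adjacency at u and w.
-- The agreement hypothesis is symmetric, so the transfer applies in both
-- directions between G and G - e with T = {x,y}, which gives (a) and (b).
-- The argument does not use that xy is an edge of G.

open import Defs
open import Data.Nat using (ℕ)
open import Data.Fin using (Fin)
open import Data.Fin.Subset using (Subset; _∪_; ⁅_⁆; _∈_; _∉_)
open import Data.Fin.Subset.Properties using (_∈?_; x∈⁅x⁆; x∈p∪q⁺)
open import Data.Product using (Σ; _×_; _,_)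
open import Data.Sum using (inj₁; inj₂)
open import Data.Bool using (true; false)
open import Data.Bool.Properties using (∧-identityʳ)
open import Data.Fin.Properties using (_≟_)
open import Relation.Nullary using (yes; no; contradiction)
open import Relation.Binary.PropositionalEquality using (_≡_; _≢_; refl; sym; trans)

d₁-cong : ∀ {n} (H H' : Graph n) (a b : Fin n) →
  adj H a b ≡ adj H' a b → d₁ H a b ≡ d₁ H' a b
d₁-cong H H' a b same with a ≟ b
... | yes _ = refl
... | no _ rewrite same = refl

d₁-self : ∀ {n} (H : Graph n) (v : Fin n) → d₁ H v v ≡ 0
d₁-self H v with v ≟ v
... | yes _ = refl
... | no v≢v = contradiction refl v≢v

d₁-pos : ∀ {n} (H : Graph n) (u v : Fin n) → u ≢ v → d₁ H u v ≢ 0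
d₁-pos H u v u≢v with u ≟ v
... | yes u≡v = λ _ → u≢v u≡v
... | no _ with adj H u v
...   | true  = λ ()
...   | false = λ ()

Resolves : ∀ {n} → Graph n → Subset n → Fin n → Fin n → Set
Resolves {n} H S u w = Σ (Fin n) λ z → z ∈ S × d₁ H u z ≢ d₁ H w z

resolves-from-left : ∀ {n} (H : Graph n) (S : Subset n) (u w : Fin n) →
  u ≢ w → u ∈ S → Resolves H S u w
resolves-from-left H S u w u≢w u∈S =
  u , u∈S , λ eq → d₁-pos H w u (λ w≡u → u≢w (sym w≡u)) (trans (sym eq) (d₁-self H u))

resolves-from-right : ∀ {n} (H : Graph n) (S : Subset n) (u w : Fin n) →
  u ≢ w → w ∈ S → Resolves H S u w
resolves-from-right H S u w u≢w w∈S =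
  w , w∈S , λ eq → d₁-pos H u w u≢w (trans eq (d₁-self H w))

AgreeOutside : ∀ {n} → Graph n → Graph n → Subset n → Set
AgreeOutside {n} H H' T = (a b : Fin n) → a ∉ T → adj H a b ≡ adj H' a b

agree-sym : ∀ {n} (H H' : Graph n) (T : Subset n) →
  AgreeOutside H H' T → AgreeOutside H' H T
agree-sym H H' T agree a b a∉T = sym (agree a b a∉T)

transfer : ∀ {n} (H H' : Graph n) (T : Subset n) → AgreeOutside H H' T →
  (S : Subset n) → AdjResolving H S → AdjResolving H' (S ∪ T)
transfer H H' T agree S resolving u w u≢w with u ∈? T | w ∈? T
... | yes u∈T | _ = resolves-from-left H' (S ∪ T) u w u≢w (x∈p∪q⁺ (inj₂ u∈T))
... | no _ | yes w∈T = resolves-from-right H' (S ∪ T) u w u≢w (x∈p∪q⁺ (inj₂ w∈T))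
... | no u∉T | no w∉T with resolving u w u≢w
...   | z , z∈S , differs = z , x∈p∪q⁺ (inj₁ z∈S) , λ eq →
        differs (trans (d₁-cong H H' u z (agree u z u∉T))
                       (trans eq (sym (d₁-cong H H' w z (agree w z w∉T)))))

∉-pair-left : ∀ {n} {x y a : Fin n} → a ∉ ⁅ x ⁆ ∪ ⁅ y ⁆ → a ≢ x
∉-pair-left {x = x} a∉ refl = a∉ (x∈p∪q⁺ (inj₁ (x∈⁅x⁆ x)))

∉-pair-right : ∀ {n} {x y a : Fin n} → a ∉ ⁅ x ⁆ ∪ ⁅ y ⁆ → a ≢ y
∉-pair-right {y = y} a∉ refl = a∉ (x∈p∪q⁺ (inj₂ (x∈⁅x⁆ y)))

deleteEdge-agrees : ∀ {n} (G : Graph n) (x y : Fin n) →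
  AgreeOutside G (deleteEdge G x y) (⁅ x ⁆ ∪ ⁅ y ⁆)
deleteEdge-agrees G x y a b a∉ with a ≟ x | a ≟ y
... | yes a≡x | _ = contradiction a≡x (∉-pair-left a∉)
... | no _ | yes a≡y = contradiction a≡y (∉-pair-right a∉)
... | no _ | no _ = sym (∧-identityʳ (adj G a b))

lemma6p6 : {n : ℕ} (G : Graph n) (x y : Fin n) → IsEdge G x y →
    ((S : Subset n) → AdjResolving G S →
      AdjResolving (deleteEdge G x y) (S ∪ (⁅ x ⁆ ∪ ⁅ y ⁆)))
  × ((R : Subset n) → AdjResolving (deleteEdge G x y) R →
      AdjResolving G (R ∪ (⁅ x ⁆ ∪ ⁅ y ⁆)))
lemma6p6 G x y _ =
    transfer G G-e xy agrees
  , transfer G-e G xy (agree-sym G G-e xy agrees)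
  where
  G-e : Graph _
  G-e = deleteEdge G x y

  xy : Subset _
  xy = ⁅ x ⁆ ∪ ⁅ y ⁆

  agrees : AgreeOutside G G-e xy
  agrees = deleteEdge-agrees G x y
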